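{- Let $H$ be an endofunctor of a category $\mathcal A$ with finite coproducts, let $(A,\alpha,(-)^\dagger)$ be a complete Elgot algebra and $m:Y\to A$ a morphism. Equip $HA+Y$ with the $H$-algebra structure $\mathrm{inl}\cdot H[\alpha,m]:H(HA+Y)\to HA+Y$ and with the assignment sending each flat equation morphism $e:X\to HX+HA+Y$ to $e^\ddagger:=([H\bar e^\dagger,\mathrm{id}_{HA}]+\mathrm{id}_Y)\cdot e:X\to HA+Y$, where $\bar e:=(\mathrm{id}_{HX}+[\alpha,m])\cdot e:X\to HX+A$. Then $(HA+Y,\mathrm{inl}\cdot H[\alpha,m],(-)^\ddagger)$ is a complete Elgot algebra and $[\alpha,m]:HA+Y\to A$ is a solution-preserving morphism into $(A,\alpha,(-)^\dagger)$.
   Context: Coproduct injections are $\mathrm{inl},\mathrm{inr}$. For an $H$-algebra $\beta:HB\to B$, a flat equation morphism in $B$ is any morphism $e:X\to HX+B$; a solution is $e^\dagger:X\to B$ with $e^\dagger=[\beta,\mathrm{id}_B]\cdot(He^\dagger+\mathrm{id}_B)\cdot e$. For $e:X\to HX+Y$ and $h:Y\to Z$, $h\bullet e:=(\mathrm{id}_{HX}+h)\cdot e$; for $e:X\to HX+Y$, $f:Y\to HY+B$, $f\oplus e:=(\mathrm{can}+\mathrm{id}_B)\cdot(\mathrm{id}_{HX}+f)\cdot[e,\mathrm{inr}]$ with $\mathrm{can}=[H\mathrm{inl},H\mathrm{inr}]$. A complete Elgot algebra is an $H$-algebra with an assignment $e\mapsto e^\dagger$ of a solution to every flat equation morphism that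 is functorial ($e^\dagger=f^\dagger\cdot h$ whenever $(Hh+\mathrm{id}_B)\cdot e=f\cdot h$) and compositional ($(f^\dagger\bullet e)^\dagger=(f\oplus e)^\dagger\cdot\mathrm{inl}$). A morphism $h$ of complete Elgot algebras $(B,\beta,(-)^\dagger)\to(C,\gamma,(-)^\ddagger)$ is solution-preserving if $h\cdot e^\dagger=(h\bullet e)^\ddagger$ for every flat equation morphism $e$ in $B$. -}

module Defs where

open import Level using (Level; _⊔_; suc)
open import Relation.Binary using (IsEquivalence)
open import Data.Product using (_×_)

record Category (o ℓ e : Level) : Set (suc (o ⊔ ℓ ⊔ e)) where
  infix  4 _≈_
  infixr 9 _∘_
  infix  4 _⇒_
  field
    Obj : Set o
    _⇒_ : Obj → Obj → Set ℓ
    _≈_ : ∀ {A B} → A ⇒ B → A ⇒ B → Set e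
    id  : ∀ {A} → A ⇒ A
    _∘_ : ∀ {A B C} → B ⇒ C → A ⇒ B → A ⇒ C
    equiv     : ∀ {A B} → IsEquivalence (_≈_ {A} {B})
    ∘-resp-≈  : ∀ {A B C} {f h : B ⇒ C} {g i : A ⇒ B} →
                f ≈ h → g ≈ i → f ∘ g ≈ h ∘ i
    assoc     : ∀ {A B C D} {f : A ⇒ B} {g : B ⇒ C} {h : C ⇒ D} →
                (h ∘ g) ∘ f ≈ h ∘ (g ∘ f)
    identityˡ : ∀ {A B} {f : A ⇒ B} → id ∘ f ≈ f
    identityʳ : ∀ {A B} {f : A ⇒ B} → f ∘ id ≈ f

record FiniteCoproducts {o ℓ e} (C : Category o ℓ e) : Set (o ⊔ ℓ ⊔ e) where
  open Category C
  infixr 6 _+_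
  field
    ⊥     : Obj
    ¡     : ∀ {A} → ⊥ ⇒ A
    ¡-unique : ∀ {A} (f : ⊥ ⇒ A) → ¡ ≈ f
    _+_   : Obj → Obj → Obj
    inl   : ∀ {A B} → A ⇒ A + B
    inr   : ∀ {A B} → B ⇒ A + B
    [_,_] : ∀ {A B D} → A ⇒ D → B ⇒ D → A + B ⇒ D
    inl-commute : ∀ {A B D} {f : A ⇒ D} {g : B ⇒ D} → [ f , g ] ∘ inl ≈ f
    inr-commute : ∀ {A B D} {f : A ⇒ D} {g : B ⇒ D} → [ f , g ] ∘ inr ≈ g
    +-unique : ∀ {A B D} {f : A ⇒ D} {g : B ⇒ D} {h : A + B ⇒ D} →
               h ∘ inl ≈ f → h ∘ inr ≈ g → [ f , g ] ≈ h

  infixr 7 _+₁_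
  _+₁_ : ∀ {A B A′ B′} → A ⇒ A′ → B ⇒ B′ → A + B ⇒ A′ + B′
  f +₁ g = [ inl ∘ f , inr ∘ g ]

  assocˡ : ∀ {A B D} → A + (B + D) ⇒ (A + B) + D
  assocˡ = [ inl ∘ inl , [ inl ∘ inr , inr ] ]

record Endofunctor {o ℓ e} (C : Category o ℓ e) : Set (o ⊔ ℓ ⊔ e) where
  open Category C
  field
    F₀ : Obj → Obj
    F₁ : ∀ {A B} → A ⇒ B → F₀ A ⇒ F₀ B
    identity     : ∀ {A} → F₁ (id {A}) ≈ id
    homomorphism : ∀ {A B D} {f : A ⇒ B} {g : B ⇒ D} → F₁ (g ∘ f) ≈ F₁ g ∘ F₁ f
    F-resp-≈     : ∀ {A B} {f g : A ⇒ B} → f ≈ g → F₁ f ≈ F₁ g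

module Elgot {o ℓ e} (C : Category o ℓ e) (CP : FiniteCoproducts C)
             (H : Endofunctor C) where
  open Category C
  open FiniteCoproducts CP
  open Endofunctor H

  _•_ : ∀ {X Y Z} → Y ⇒ Z → X ⇒ F₀ X + Y → X ⇒ F₀ X + Z
  h • e′ = (id +₁ h) ∘ e′

  can : ∀ {X Y} → F₀ X + F₀ Y ⇒ F₀ (X + Y)
  can = [ F₁ inl , F₁ inr ]

  -- f ⊕ e := (can + id_B) · (id_HX + f) · [e, inr], where the codomain
  -- HX + (HY + B) of (id_HX + f) is read via the canonical reassociation
  -- to (HX + HY) + B.
  _⊕_ : ∀ {X Y B} → Y ⇒ F₀ Y + B → X ⇒ F₀ X + Y → X + Y ⇒ F₀ (X + Y) + B
  f ⊕ e′ = (can +₁ id) ∘ (assocˡ ∘ ((id +₁ f) ∘ [ e′ , inr ]))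

  record IsCompleteElgot (B : Obj) (β : F₀ B ⇒ B)
                         (_† : ∀ {X} → X ⇒ F₀ X + B → X ⇒ B) : Set (o ⊔ ℓ ⊔ e) where
    field
      solution : ∀ {X} (e′ : X ⇒ F₀ X + B) →
                 e′ † ≈ [ β , id ] ∘ ((F₁ (e′ †) +₁ id) ∘ e′)
      functorial : ∀ {X Z} (e′ : X ⇒ F₀ X + B) (f : Z ⇒ F₀ Z + B) (h : X ⇒ Z) →
                   (F₁ h +₁ id) ∘ e′ ≈ f ∘ h → e′ † ≈ (f †) ∘ h
      compositional : ∀ {X Y} (e′ : X ⇒ F₀ X + Y) (f : Y ⇒ F₀ Y + B) →
                      ((f †) • e′) † ≈ ((f ⊕ e′) †) ∘ inl

  record CompleteElgotAlgebra : Set (o ⊔ ℓ ⊔ e) where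
    field
      carrier : Obj
      alg     : F₀ carrier ⇒ carrier
      _†      : ∀ {X} → X ⇒ F₀ X + carrier → X ⇒ carrier
      isCompleteElgot : IsCompleteElgot carrier alg _†

  SolutionPreserving : ∀ {B D} →
                       (∀ {X} → X ⇒ F₀ X + B → X ⇒ B) →
                       (∀ {X} → X ⇒ F₀ X + D → X ⇒ D) →
                       B ⇒ D → Set (o ⊔ ℓ ⊔ e)
  SolutionPreserving {B} _† _‡ h =
    ∀ {X} (e′ : X ⇒ F₀ X + B) → h ∘ (e′ †) ≈ (h • e′) ‡

  module Construction (𝔸 : CompleteElgotAlgebra) {Y : Obj} (m : Y ⇒ CompleteElgotAlgebra.carrier 𝔸) where
    open CompleteElgotAlgebra 𝔸 renaming (carrier to A; alg to α)

    B : Obj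
    B = F₀ A + Y

    β : F₀ B ⇒ B
    β = inl ∘ F₁ [ α , m ]

    bar : ∀ {X} → X ⇒ F₀ X + B → X ⇒ F₀ X + A
    bar e′ = (id +₁ [ α , m ]) ∘ e′

    -- e‡ := ([H ē†, id_HA] + id_Y) · e, where e : X → HX + HA + Y is read
    -- via the canonical reassociation HX + (HA + Y) ≅ (HX + HA) + Y.
    _‡ : ∀ {X} → X ⇒ F₀ X + B → X ⇒ B
    e′ ‡ = ([ F₁ (bar e′ †) , id ] +₁ id) ∘ (assocˡ ∘ e′)

{-# OPTIONS --safe #-}
-- Everything rests on the identity  e‡ = [inl · H(ē†), id] · e : to solve e in HA + Y,
-- solve its image ē = [α,m] • e in A and apply one layer of H to the result, leaving the
-- summand HA + Y of e untouched.  Composing with [α, m] and using the solution law of †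
-- for ē turns this into [α, m] · e‡ = ē†, which is solution preservation.  The three laws
-- of ‡ then follow from the corresponding laws of † for ē, because e ↦ ē commutes with
-- the operations on equation morphisms: [α,m] • (f ⊕ e) = ([α,m] • f) ⊕ e, and
-- [α,m] • (f‡ • e) = ([α,m] · f‡) • e = f̄† • e.
module Submission where

open import Defs
open import Data.Product using (_×_; _,_)
open import Relation.Binary using (IsEquivalence; Setoid)
import Relation.Binary.Reasoning.Setoid as SetoidReasoning

module CategoryProperties {o ℓ e} (C : Category o ℓ e) where
  open Category C

  module Equiv {A B : Obj} = IsEquivalence (equiv {A} {B})
  open Equiv public using (refl; sym; trans)

  hom-setoid : Obj → Obj → Setoid ℓ e
  hom-setoid A B = record { Carrier = A ⇒ B ; _≈_ = _≈_ ; isEquivalence = equiv }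

  module HomReasoning {A B : Obj} = SetoidReasoning (hom-setoid A B)

  private variable
    f g h k : _ ⇒ _

  ∘-resp-≈ˡ : f ≈ h → f ∘ g ≈ h ∘ g
  ∘-resp-≈ˡ p = ∘-resp-≈ p refl

  ∘-resp-≈ʳ : g ≈ k → f ∘ g ≈ f ∘ k
  ∘-resp-≈ʳ p = ∘-resp-≈ refl p

  sym-assoc : h ∘ (g ∘ f) ≈ (h ∘ g) ∘ f
  sym-assoc = sym assoc

  pullˡ : g ∘ f ≈ h → g ∘ (f ∘ k) ≈ h ∘ k
  pullˡ p = trans sym-assoc (∘-resp-≈ˡ p)

  pullʳ : f ∘ g ≈ h → (k ∘ f) ∘ g ≈ k ∘ h
  pullʳ p = trans assoc (∘-resp-≈ʳ p)

module CoproductProperties {o ℓ e} {C : Category o ℓ e} (CP : FiniteCoproducts C) where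
  open Category C
  open FiniteCoproducts CP
  open CategoryProperties C

  private variable
    f f′ g g′ h k : _ ⇒ _

  []-cong₂ : f ≈ f′ → g ≈ g′ → [ f , g ] ≈ [ f′ , g′ ]
  []-cong₂ p q = +-unique (trans inl-commute (sym p)) (trans inr-commute (sym q))

  ∘-distribˡ-[] : h ∘ [ f , g ] ≈ [ h ∘ f , h ∘ g ]
  ∘-distribˡ-[] = sym (+-unique (trans assoc (∘-resp-≈ʳ inl-commute))
                                (trans assoc (∘-resp-≈ʳ inr-commute)))

  []∘+₁ : [ f , g ] ∘ (h +₁ k) ≈ [ f ∘ h , g ∘ k ]
  []∘+₁ = trans ∘-distribˡ-[] ([]-cong₂ (pullˡ inl-commute) (pullˡ inr-commute))

  +₁∘+₁ : (f +₁ g) ∘ (h +₁ k) ≈ (f ∘ h) +₁ (g ∘ k)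
  +₁∘+₁ = trans []∘+₁ ([]-cong₂ assoc assoc)

  +₁-cong₂ : f ≈ f′ → g ≈ g′ → f +₁ g ≈ f′ +₁ g′
  +₁-cong₂ p q = []-cong₂ (∘-resp-≈ʳ p) (∘-resp-≈ʳ q)

  +₁-identity : ∀ {A B} → id {A} +₁ id {B} ≈ id
  +₁-identity = +-unique id-commutes id-commutes
    where
    id-commutes : ∀ {U V} {i : U ⇒ V} → id ∘ i ≈ i ∘ id
    id-commutes = trans identityˡ (sym identityʳ)

  +₁-factorˡ : f +₁ g ≈ (f +₁ id) ∘ (id +₁ g)
  +₁-factorˡ = sym (trans +₁∘+₁ (+₁-cong₂ identityʳ identityˡ))

  +₁-factorʳ : f +₁ g ≈ (id +₁ g) ∘ (f +₁ id)
  +₁-factorʳ = sym (trans +₁∘+₁ (+₁-cong₂ identityˡ identityʳ))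

  +₁-interchange : (f +₁ id) ∘ (id +₁ g) ≈ (id +₁ g) ∘ (f +₁ id)
  +₁-interchange = trans (sym +₁-factorˡ) +₁-factorʳ

  id+₁-absorbs-inl : (id +₁ h) ∘ (inl ∘ f) ≈ inl ∘ f
  id+₁-absorbs-inl = pullˡ (trans inl-commute identityʳ)

  +₁∘assocˡ : (g +₁ h) ∘ assocˡ ≈ [ inl ∘ (g ∘ inl) , (g ∘ inr) +₁ h ]
  +₁∘assocˡ {g = g} {h = h} = trans ∘-distribˡ-[] ([]-cong₂ inl-part inr-part)
    where
    open HomReasoning
    inl-part : ∀ {W} {i : W ⇒ _} → (g +₁ h) ∘ (inl ∘ i) ≈ inl ∘ (g ∘ i)
    inl-part = trans (pullˡ inl-commute) assoc
    inr-part : (g +₁ h) ∘ [ inl ∘ inr , inr ] ≈ (g ∘ inr) +₁ h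
    inr-part = begin
      (g +₁ h) ∘ [ inl ∘ inr , inr ]                ≈⟨ ∘-distribˡ-[] ⟩
      [ (g +₁ h) ∘ (inl ∘ inr) , (g +₁ h) ∘ inr ]   ≈⟨ []-cong₂ inl-part inr-commute ⟩
      (g ∘ inr) +₁ h                                ∎

module EquationProperties {o ℓ e} (C : Category o ℓ e) (CP : FiniteCoproducts C)
                          (H : Endofunctor C) where
  open Category C
  open FiniteCoproducts CP
  open Endofunctor H
  open Elgot C CP H
  open CategoryProperties C
  open CoproductProperties CP
  open HomReasoning

  private variable
    e′ f g h : _ ⇒ _

  •-resp-≈ : g ≈ h → g • e′ ≈ h • e′
  •-resp-≈ p = ∘-resp-≈ˡ (+₁-cong₂ refl p)

  ∘-• : (h ∘ g) • e′ ≈ h • (g • e′)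
  ∘-• = trans (∘-resp-≈ˡ (trans (+₁-cong₂ (sym identityˡ) refl) (sym +₁∘+₁)))
              assoc

  •-preserves-morphism : (F₁ h +₁ id) ∘ e′ ≈ f ∘ h →
                         (F₁ h +₁ id) ∘ (g • e′) ≈ (g • f) ∘ h
  •-preserves-morphism {h = h} {e′ = e′} {f = f} {g = g} p = begin
    (F₁ h +₁ id) ∘ ((id +₁ g) ∘ e′)   ≈⟨ pullˡ +₁-interchange ⟩
    ((id +₁ g) ∘ (F₁ h +₁ id)) ∘ e′   ≈⟨ pullʳ p ⟩
    (id +₁ g) ∘ (f ∘ h)               ≈⟨ sym-assoc ⟩
    ((id +₁ g) ∘ f) ∘ h               ∎

  plug : ∀ {X Y D} → Y ⇒ F₀ Y + D → F₀ X + Y ⇒ F₀ (X + Y) + D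
  plug f = [ inl ∘ F₁ inl , (F₁ inr +₁ id) ∘ f ]

  ⊕-unfold : f ⊕ e′ ≈ plug f ∘ [ e′ , inr ]
  ⊕-unfold {f = f} {e′ = e′} = begin
    (can +₁ id) ∘ (assocˡ ∘ ((id +₁ f) ∘ [ e′ , inr ]))
      ≈⟨ pullˡ can+₁id∘assocˡ ⟩
    [ inl ∘ F₁ inl , F₁ inr +₁ id ] ∘ ((id +₁ f) ∘ [ e′ , inr ])
      ≈⟨ pullˡ []∘+₁ ⟩
    [ (inl ∘ F₁ inl) ∘ id , (F₁ inr +₁ id) ∘ f ] ∘ [ e′ , inr ]
      ≈⟨ ∘-resp-≈ˡ ([]-cong₂ identityʳ refl) ⟩
    plug f ∘ [ e′ , inr ]
      ∎
    where
    can+₁id∘assocˡ : (can +₁ id) ∘ assocˡ ≈ [ inl ∘ F₁ inl , F₁ inr +₁ id ]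
    can+₁id∘assocˡ =
      trans +₁∘assocˡ ([]-cong₂ (∘-resp-≈ʳ inl-commute) (+₁-cong₂ inr-commute refl))

  ⊕∘inl : (f ⊕ e′) ∘ inl ≈ plug f ∘ e′
  ⊕∘inl = trans (∘-resp-≈ˡ ⊕-unfold) (pullʳ inl-commute)

  ⊕∘inr : (f ⊕ e′) ∘ inr ≈ (F₁ inr +₁ id) ∘ f
  ⊕∘inr = trans (∘-resp-≈ˡ ⊕-unfold) (trans (pullʳ inr-commute) inr-commute)

  plug-natural : ∀ {X} → (id +₁ h) ∘ plug {X} f ≈ plug {X} (h • f)
  plug-natural {h = h} {f = f} = begin
    (id +₁ h) ∘ [ inl ∘ F₁ inl , (F₁ inr +₁ id) ∘ f ]
      ≈⟨ ∘-distribˡ-[] ⟩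
    [ (id +₁ h) ∘ (inl ∘ F₁ inl) , (id +₁ h) ∘ ((F₁ inr +₁ id) ∘ f) ]
      ≈⟨ []-cong₂ id+₁-absorbs-inl (trans (pullˡ (sym +₁-interchange)) assoc) ⟩
    [ inl ∘ F₁ inl , (F₁ inr +₁ id) ∘ ((id +₁ h) ∘ f) ]
      ∎

  •-⊕ : h • (f ⊕ e′) ≈ (h • f) ⊕ e′
  •-⊕ {h = h} {f = f} {e′ = e′} = begin
    (id +₁ h) ∘ (f ⊕ e′)                  ≈⟨ ∘-resp-≈ʳ ⊕-unfold ⟩
    (id +₁ h) ∘ (plug f ∘ [ e′ , inr ])   ≈⟨ pullˡ plug-natural ⟩
    plug (h • f) ∘ [ e′ , inr ]           ≈⟨ ⊕-unfold ⟨
    (h • f) ⊕ e′                          ∎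

  module ElgotProperties {B β} {_† : ∀ {X} → X ⇒ F₀ X + B → X ⇒ B}
                         (elgot : IsCompleteElgot B β _†) where
    open IsCompleteElgot elgot

    †-resp-≈ : ∀ {X} {e′ e″ : X ⇒ F₀ X + B} → e′ ≈ e″ → e′ † ≈ e″ †
    †-resp-≈ {e′ = e′} {e″ = e″} p =
      trans (functorial e′ e″ id F₁id-morphism) identityʳ
      where
      F₁id-morphism : (F₁ id +₁ id) ∘ e′ ≈ e″ ∘ id
      F₁id-morphism = begin
        (F₁ id +₁ id) ∘ e′
          ≈⟨ ∘-resp-≈ˡ (trans (+₁-cong₂ identity refl) +₁-identity) ⟩
        id ∘ e′
          ≈⟨ trans identityˡ (trans p (sym identityʳ)) ⟩
        e″ ∘ id
          ∎

    †-⊕∘inr : ((f ⊕ e′) †) ∘ inr ≈ f †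
    †-⊕∘inr {f = f} {e′ = e′} = sym (functorial f (f ⊕ e′) inr (sym ⊕∘inr))

module ConstructionProperties {o ℓ e} (C : Category o ℓ e) (CP : FiniteCoproducts C)
                              (H : Endofunctor C) (𝔸 : Elgot.CompleteElgotAlgebra C CP H)
                              {Y : Category.Obj C}
                              (m : Category._⇒_ C Y (Elgot.CompleteElgotAlgebra.carrier 𝔸)) where
  open Category C
  open FiniteCoproducts CP
  open Endofunctor H
  open Elgot C CP H
  open CategoryProperties C
  open CoproductProperties CP
  open EquationProperties C CP H
  open HomReasoning
  open CompleteElgotAlgebra 𝔸 renaming (carrier to A; alg to α)
  open IsCompleteElgot isCompleteElgot
  open ElgotProperties isCompleteElgot
  open Construction 𝔸 m

  expand : ∀ {X} → X ⇒ A → F₀ X + B ⇒ B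
  expand s = [ inl ∘ F₁ s , id ]

  expand-resp-≈ : ∀ {X} {s t : X ⇒ A} → s ≈ t → expand s ≈ expand t
  expand-resp-≈ p = []-cong₂ (∘-resp-≈ʳ (F-resp-≈ p)) refl

  expand-F₁ : ∀ {X Z} {s : Z ⇒ A} {h : X ⇒ Z} →
              expand (s ∘ h) ≈ expand s ∘ (F₁ h +₁ id)
  expand-F₁ {s = s} {h = h} = begin
    [ inl ∘ F₁ (s ∘ h) , id ]            ≈⟨ []-cong₂ (pullʳ (sym homomorphism)) identityˡ ⟨
    [ (inl ∘ F₁ s) ∘ F₁ h , id ∘ id ]    ≈⟨ []∘+₁ ⟨
    [ inl ∘ F₁ s , id ] ∘ (F₁ h +₁ id)   ∎

  ‡-unfold : ∀ {X} (e′ : X ⇒ F₀ X + B) → e′ ‡ ≈ expand (bar e′ †) ∘ e′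
  ‡-unfold {X} e′ = trans sym-assoc (∘-resp-≈ˡ (begin
    ([ F₁ s , id ] +₁ id) ∘ assocˡ
      ≈⟨ +₁∘assocˡ ⟩
    [ inl ∘ ([ F₁ s , id ] ∘ inl) , ([ F₁ s , id ] ∘ inr) +₁ id ]
      ≈⟨ []-cong₂ (∘-resp-≈ʳ inl-commute) (trans (+₁-cong₂ inr-commute refl) +₁-identity) ⟩
    expand s
      ∎))
    where
    s : X ⇒ A
    s = bar e′ †

  solution-preserving : SolutionPreserving _‡ _† [ α , m ]
  solution-preserving {X} e′ = begin
    [ α , m ] ∘ e′ ‡
      ≈⟨ ∘-resp-≈ʳ (‡-unfold e′) ⟩
    [ α , m ] ∘ (expand s ∘ e′)
      ≈⟨ pullˡ ∘-distribˡ-[] ⟩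
    [ [ α , m ] ∘ (inl ∘ F₁ s) , [ α , m ] ∘ id ] ∘ e′
      ≈⟨ ∘-resp-≈ˡ ([]-cong₂ (pullˡ inl-commute) (trans identityʳ (sym identityˡ))) ⟩
    [ α ∘ F₁ s , id ∘ [ α , m ] ] ∘ e′
      ≈⟨ ∘-resp-≈ˡ (trans (∘-resp-≈ʳ (sym +₁-factorˡ)) []∘+₁) ⟨
    ([ α , id ] ∘ ((F₁ s +₁ id) ∘ (id +₁ [ α , m ]))) ∘ e′
      ≈⟨ trans assoc (∘-resp-≈ʳ assoc) ⟩
    [ α , id ] ∘ ((F₁ s +₁ id) ∘ bar e′)
      ≈⟨ solution (bar e′) ⟨
    bar e′ †
      ∎
    where
    s : X ⇒ A
    s = bar e′ †

  ‡-solution : ∀ {X} (e′ : X ⇒ F₀ X + B) →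
               e′ ‡ ≈ [ β , id ] ∘ ((F₁ (e′ ‡) +₁ id) ∘ e′)
  ‡-solution e′ = begin
    e′ ‡
      ≈⟨ ‡-unfold e′ ⟩
    expand (bar e′ †) ∘ e′
      ≈⟨ ∘-resp-≈ˡ ([]-cong₂ one-layer (sym identityˡ)) ⟩
    [ β ∘ F₁ (e′ ‡) , id ∘ id ] ∘ e′
      ≈⟨ ∘-resp-≈ˡ []∘+₁ ⟨
    ([ β , id ] ∘ (F₁ (e′ ‡) +₁ id)) ∘ e′
      ≈⟨ assoc ⟩
    [ β , id ] ∘ ((F₁ (e′ ‡) +₁ id) ∘ e′)
      ∎
    where
    one-layer : inl ∘ F₁ (bar e′ †) ≈ β ∘ F₁ (e′ ‡)
    one-layer = begin
      inl ∘ F₁ (bar e′ †)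
        ≈⟨ ∘-resp-≈ʳ (F-resp-≈ (sym (solution-preserving e′))) ⟩
      inl ∘ F₁ ([ α , m ] ∘ e′ ‡)
        ≈⟨ trans (∘-resp-≈ʳ homomorphism) sym-assoc ⟩
      β ∘ F₁ (e′ ‡)
        ∎

  ‡-functorial : ∀ {X Z} (e′ : X ⇒ F₀ X + B) (f : Z ⇒ F₀ Z + B) (h : X ⇒ Z) →
                 (F₁ h +₁ id) ∘ e′ ≈ f ∘ h → e′ ‡ ≈ (f ‡) ∘ h
  ‡-functorial e′ f h p = begin
    e′ ‡                                     ≈⟨ ‡-unfold e′ ⟩
    expand (bar e′ †) ∘ e′                   ≈⟨ ∘-resp-≈ˡ (expand-resp-≈ bar-†-natural) ⟩
    expand (bar f † ∘ h) ∘ e′                ≈⟨ ∘-resp-≈ˡ expand-F₁ ⟩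
    (expand (bar f †) ∘ (F₁ h +₁ id)) ∘ e′   ≈⟨ pullʳ p ⟩
    expand (bar f †) ∘ (f ∘ h)               ≈⟨ pullˡ (sym (‡-unfold f)) ⟩
    (f ‡) ∘ h                                ∎
    where
    bar-†-natural : bar e′ † ≈ bar f † ∘ h
    bar-†-natural = functorial (bar e′) (bar f) h (•-preserves-morphism p)

  expand∘plug : ∀ {X Y′} {s : X + Y′ ⇒ A} {f : Y′ ⇒ F₀ Y′ + B} →
                expand s ∘ plug f ≈ [ inl ∘ F₁ (s ∘ inl) , expand (s ∘ inr) ∘ f ]
  expand∘plug {s = s} {f = f} = trans ∘-distribˡ-[] ([]-cong₂ inl-part inr-part)
    where
    inl-part : expand s ∘ (inl ∘ F₁ inl) ≈ inl ∘ F₁ (s ∘ inl)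
    inl-part = begin
      expand s ∘ (inl ∘ F₁ inl)   ≈⟨ pullˡ inl-commute ⟩
      (inl ∘ F₁ s) ∘ F₁ inl       ≈⟨ pullʳ (sym homomorphism) ⟩
      inl ∘ F₁ (s ∘ inl)          ∎
    inr-part : expand s ∘ ((F₁ inr +₁ id) ∘ f) ≈ expand (s ∘ inr) ∘ f
    inr-part = pullˡ (sym expand-F₁)

  ‡-compositional : ∀ {X Y′} (e′ : X ⇒ F₀ X + Y′) (f : Y′ ⇒ F₀ Y′ + B) →
                    ((f ‡) • e′) ‡ ≈ ((f ⊕ e′) ‡) ∘ inl
  ‡-compositional {X} {Y′} e′ f = begin
    ((f ‡) • e′) ‡
      ≈⟨ trans (‡-unfold ((f ‡) • e′)) (pullˡ []∘+₁) ⟩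
    [ (inl ∘ F₁ (bar ((f ‡) • e′) †)) ∘ id , id ∘ f ‡ ] ∘ e′
      ≈⟨ ∘-resp-≈ˡ ([]-cong₂ variables-of-e′ variables-of-f) ⟩
    [ inl ∘ F₁ (s ∘ inl) , expand (s ∘ inr) ∘ f ] ∘ e′
      ≈⟨ ∘-resp-≈ˡ expand∘plug ⟨
    (expand s ∘ plug f) ∘ e′
      ≈⟨ pullʳ (sym ⊕∘inl) ⟩
    expand s ∘ ((f ⊕ e′) ∘ inl)
      ≈⟨ ∘-resp-≈ˡ (expand-resp-≈ (†-resp-≈ •-⊕)) ⟨
    expand (bar (f ⊕ e′) †) ∘ ((f ⊕ e′) ∘ inl)
      ≈⟨ pullˡ (sym (‡-unfold (f ⊕ e′))) ⟩
    ((f ⊕ e′) ‡) ∘ inl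
      ∎
    where
    s : X + Y′ ⇒ A
    s = (bar f ⊕ e′) †
    restrict-inl : bar ((f ‡) • e′) † ≈ s ∘ inl
    restrict-inl = begin
      bar ((f ‡) • e′) †
        ≈⟨ †-resp-≈ (sym ∘-•) ⟩
      (([ α , m ] ∘ f ‡) • e′) †
        ≈⟨ †-resp-≈ (•-resp-≈ (solution-preserving f)) ⟩
      ((bar f †) • e′) †
        ≈⟨ compositional e′ (bar f) ⟩
      s ∘ inl
        ∎
    restrict-inr : bar f † ≈ s ∘ inr
    restrict-inr = sym †-⊕∘inr
    variables-of-e′ : (inl ∘ F₁ (bar ((f ‡) • e′) †)) ∘ id ≈ inl ∘ F₁ (s ∘ inl)
    variables-of-e′ = trans identityʳ (∘-resp-≈ʳ (F-resp-≈ restrict-inl))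
    variables-of-f : id ∘ f ‡ ≈ expand (s ∘ inr) ∘ f
    variables-of-f =
      trans identityˡ (trans (‡-unfold f) (∘-resp-≈ˡ (expand-resp-≈ restrict-inr)))

  ‡-isCompleteElgot : IsCompleteElgot B β _‡
  ‡-isCompleteElgot = record
    { solution      = ‡-solution
    ; functorial    = ‡-functorial
    ; compositional = ‡-compositional
    }

lemma5p6 : ∀ {o ℓ e} (C : Category o ℓ e) (CP : FiniteCoproducts C)
             (H : Endofunctor C) →
           let open Category C
               open FiniteCoproducts CP
               open Elgot C CP H
           in (𝔸 : CompleteElgotAlgebra) (Y : Obj)
              (m : Y ⇒ CompleteElgotAlgebra.carrier 𝔸) →
              let open Construction 𝔸 m
              in IsCompleteElgot B β _‡
                 × SolutionPreserving _‡ (CompleteElgotAlgebra._† 𝔸) [ CompleteElgotAlgebra.alg 𝔸 , m ]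
lemma5p6 C CP H 𝔸 Y m = ‡-isCompleteElgot , solution-preserving
  where open ConstructionProperties C CP H 𝔸 m
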